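{- Let $\mathcal{A}$ be a union-closed family with universe $[n]$ and length $\ell$, let $C_1=[n]\supsetneq C_2\supsetneq\cdots\supsetneq C_{\ell+1}$ be a chain in $\mathcal{A}$ of maximum size, and define $\mathcal{D}_i$ for $i\in[\ell]$ as in the context. Then \[|\mathcal{A}| = 1+\sum_{i=1}^{\ell}|\mathcal{D}_i|.\]
   Context: A family is a finite family of distinct finite sets, at least one of which is nonempty; its universe is $U(\mathcal{A})=\bigcup_{A\in\mathcal{A}}A$. $\mathcal{A}$ is union-closed if $X_1,X_2\in\mathcal{A}$ implies $X_1\cup X_2\in\mathcal{A}$. A chain is a subfamily any two of whose members are comparable under inclusion; the length $\ell(\mathcal{A})$ is one less than the maximum size of a chain in $\mathcal{A}$. Note that $[n]\in\mathcal{A}$ and belongs to every maximum chain, so a maximum chain can be written $C_1=[n]\supsetneq C_2\supsetneq\cdots\supsetneq C_{\ell+1}$. With $[0]=\emptyset$, for each $i\in[\ell]$ define \[\mathcal{C}_i=\Big\{X\in\mathcal{A} : C_i\setminus C_{i+1}\subseteq X \text{ and } X\cap \textstyle\bigcup_{j\in[i-1]}(C_j\setminus C_{j+1})=\emptyset\Big\},\qquad \mathcal{D}_i=\{X\setminus (C_i\setminus C_{i+1}) : X\in\mathcal{C}_i\}.\] -}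

module Defs where

open import Data.Nat using (ℕ; suc; _≤_; _<?_)
open import Data.Bool using (Bool)
open import Data.Bool.Properties using () renaming (_≟_ to _≟ᵇ_)
open import Data.Fin using (Fin; toℕ; inject₁) renaming (suc to fsuc)
open import Data.Fin.Subset using (Subset; _⊆_; _∪_; _∩_; _─_; ⊥; ⊤)
open import Data.Fin.Subset.Properties using (_⊆?_)
open import Data.Vec.Properties using (≡-dec)
open import Data.List using (List; length; map; filter; foldr; allFin; deduplicate)
open import Data.Nat.ListAction using (sum)
open import Data.List.Membership.Propositional using (_∈_)
open import Data.List.Relation.Unary.Unique.Propositional using (Unique)
open import Data.List.Relation.Unary.All using (All)
open import Data.List.Relation.Unary.AllPairs using (AllPairs)
open import Data.List.Relation.Unary.Any using (Any)
open import Data.Product using (_×_)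
open import Data.Sum using (_⊎_)
open import Relation.Binary.PropositionalEquality using (_≡_)
open import Relation.Nullary using (Dec; _×-dec_; ¬_)
open import Data.Fin.Subset using (Nonempty)

_≟ˢ_ : ∀ {n} (X Y : Subset n) → Dec (X ≡ Y)
_≟ˢ_ = ≡-dec _≟ᵇ_

Family : ℕ → Set
Family n = List (Subset n)

⋃ : ∀ {n} → List (Subset n) → Subset n
⋃ = foldr _∪_ ⊥

IsFamily : ∀ {n} → Family n → Set
IsFamily A = Unique A × Any Nonempty A

UnionClosed : ∀ {n} → Family n → Set
UnionClosed A = ∀ X Y → X ∈ A → Y ∈ A → (X ∪ Y) ∈ A

HasUniverse : ∀ {n} → Family n → Set
HasUniverse A = ⋃ A ≡ ⊤

Comparable : ∀ {n} → Subset n → Subset n → Set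
Comparable X Y = X ⊆ Y ⊎ Y ⊆ X

IsChainIn : ∀ {n} → Family n → List (Subset n) → Set
IsChainIn A L = All (_∈ A) L × Unique L × AllPairs Comparable L

-- C : Fin (ℓ+1) → Subset n, with C 0 = C_1, ..., C ℓ = C_{ℓ+1}.
-- C_i ⊋ C_{i+1}: for i : Fin ℓ,  C (i+1) ⊂ C i.
IsMaxChain : ∀ {n} ℓ → Family n → (Fin (suc ℓ) → Subset n) → Set
IsMaxChain ℓ A C =
  (∀ i → C i ∈ A) ×
  (∀ (i : Fin ℓ) → C (fsuc i) ⊆ C (inject₁ i) × ¬ (C (fsuc i) ≡ C (inject₁ i))) ×
  (∀ L → IsChainIn A L → length L ≤ suc ℓ)

module _ {n ℓ : ℕ} (A : Family n) (C : Fin (suc ℓ) → Subset n) where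

  -- C_i \ C_{i+1}  (for the paper's index i = toℕ i + 1)
  Δ : Fin ℓ → Subset n
  Δ i = C (inject₁ i) ─ C (fsuc i)

  before : Fin ℓ → Subset n
  before i = ⋃ (map Δ (filter (λ j → toℕ j <? toℕ i) (allFin ℓ)))

  inC? : (i : Fin ℓ) (X : Subset n) → Dec (Δ i ⊆ X × (X ∩ before i) ≡ ⊥)
  inC? i X = (Δ i ⊆? X) ×-dec ((X ∩ before i) ≟ˢ ⊥)

  𝒞 : Fin ℓ → Family n
  𝒞 i = filter (inC? i) A

  𝒟 : Fin ℓ → Family n
  𝒟 i = deduplicate _≟ˢ_ (map (λ X → X ─ Δ i) (𝒞 i))

  sumD : ℕ
  sumD = sum (map (λ i → length (𝒟 i)) (allFin ℓ))

-- For X ∈ 𝒜 the indicator k ↦ [X ⊆ C_k] is antitone along the chain and equals 1 at C_1 = [n];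
-- at the bottom it equals [X = C_{ℓ+1}], since a member of 𝒜 strictly below C_{ℓ+1} would extend
-- the chain. It drops between C_i and C_{i+1} exactly when X ∈ 𝒞_i: if X ⊆ C_i but X ⊈ C_{i+1},
-- then X ∪ C_{i+1} ∈ 𝒜 lies between C_{i+1} and C_i, so by maximality it is C_i, whence
-- C_i ∖ C_{i+1} ⊆ X. Telescoping gives [X = C_{ℓ+1}] + Σᵢ [X ∈ 𝒞_i] = 1, and summing over 𝒜 gives
-- |𝒜| = 1 + Σᵢ |𝒞_i|. Finally |𝒟_i| = |𝒞_i|, as removing C_i ∖ C_{i+1} is injective on the sets
-- containing it.

module Submission where

open import Defs
open import Data.Nat using (ℕ; zero; suc; _+_; _∸_; z≤n; s≤s; s≤s⁻¹)
import Data.Nat as ℕ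
import Data.Nat.Properties as ℕₚ
open import Algebra.Properties.CommutativeSemigroup ℕₚ.+-commutativeSemigroup using (interchange)
open import Data.Nat.ListAction using (sum)
open import Data.Fin using (Fin; toℕ; inject₁; fromℕ; _≤_; _<_) renaming (zero to fzero; suc to fsuc)
open import Data.Fin.Properties using (toℕ-inject₁; ≤fromℕ; ≤-antisym; <⇒≢; any?; _≤?_)
open import Data.Fin.Subset using (Subset; ⊤; ⊥; _∈_; _∉_; _⊆_; _∪_; _∩_; _─_; Nonempty; outside)
open import Data.Fin.Subset.Properties
  using (_∈?_; _⊆?_; ⊆-refl; ⊆-antisym; ⊆-trans; ⊆-reflexive; ∈⊤; ∉⊥; Empty-unique;
         x∈p∪q⁻; x∈p∪q⁺; p⊆p∪q; q⊆p∪q; x∈p∩q⁻; x∈p∩q⁺; x∈p∧x∉q⇒x∈p─q; p─q⊆p)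
open import Data.Vec using (_∷_)
import Data.Vec as Vec
open import Data.List using (List; []; _∷_; length; map; filter; allFin; tabulate; deduplicate)
open import Data.List.Properties
  using (map-cong; map-cong-local; map-tabulate; length-map; length-tabulate;
         filter-accept; filter-reject; filter-none; filter-all)
open import Data.List.Membership.Propositional using () renaming (_∈_ to _∈ₗ_)
open import Data.List.Membership.Propositional.Properties using (∈-map⁻; ∈-map⁺; ∈-filter⁻; ∈-filter⁺; ∈-allFin)
open import Data.List.Relation.Unary.All as All using (All; []; _∷_)
open import Data.List.Relation.Unary.All.Properties using (all-filter) renaming (tabulate⁺ to All-tabulate⁺; map⁺ to All-map⁺)
open import Data.List.Relation.Unary.AllPairs using ([]; _∷_)
open import Data.List.Relation.Unary.AllPairs.Properties using (tabulate⁺-<)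
open import Data.List.Relation.Unary.Any using (here; there)
open import Data.List.Relation.Unary.Unique.Propositional using (Unique)
import Data.List.Relation.Unary.Unique.Propositional.Properties as Unique
open import Data.Product using (_×_; _,_; proj₁; proj₂; ∃)
open import Data.Empty using (⊥-elim)
open import Data.Sum using (inj₁; inj₂; [_,_])
open import Level using (Level)
open import Function using (_∘_; _⇔_; mk⇔; Equivalence)
open import Relation.Binary.Definitions using (DecidableEquality; Reflexive; Transitive)
open import Relation.Binary.PropositionalEquality using (_≡_; refl; sym; trans; cong; cong₂; subst; module ≡-Reasoning)
open import Relation.Nullary using (Dec; yes; no; ¬_; ¬?; contradiction)
open import Relation.Nullary.Decidable using (_×-dec_)
open import Relation.Unary using (Pred; Decidable)

open ≡-Reasoning

private
  variable
    a b c p q : Level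
    A : Set a
    B : Set b
    I : Set c

indicator : {P : Set p} → Dec P → ℕ
indicator (yes _) = 1
indicator (no _)  = 0

indicator-yes : {P : Set p} (P? : Dec P) → P → indicator P? ≡ 1
indicator-yes (yes _) _ = refl
indicator-yes (no ¬p) p = contradiction p ¬p

module _ {P : Set p} {Q : Set q} where

  indicator-cong : (P? : Dec P) (Q? : Dec Q) → P ⇔ Q → indicator P? ≡ indicator Q?
  indicator-cong (yes _) (yes _) _   = refl
  indicator-cong (no _)  (no _)  _   = refl
  indicator-cong (yes p) (no ¬q) P⇔Q = contradiction (Equivalence.to P⇔Q p) ¬q
  indicator-cong (no ¬p) (yes q) P⇔Q = contradiction (Equivalence.from P⇔Q q) ¬p

  indicator-mono : (P? : Dec P) (Q? : Dec Q) → (Q → P) → indicator Q? ℕ.≤ indicator P?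
  indicator-mono _       (no _)  _   = z≤n
  indicator-mono (yes _) (yes _) _   = ℕₚ.≤-refl
  indicator-mono (no ¬p) (yes q) Q⇒P = contradiction (Q⇒P q) ¬p

  indicator-×-¬ : (P? : Dec P) (Q? : Dec Q) → (Q → P) →
                  indicator (P? ×-dec ¬? Q?) ≡ indicator P? ∸ indicator Q?
  indicator-×-¬ (yes _) (yes _) _   = refl
  indicator-×-¬ (yes _) (no _)  _   = refl
  indicator-×-¬ (no _)  (no _)  _   = refl
  indicator-×-¬ (no ¬p) (yes q) Q⇒P = contradiction (Q⇒P q) ¬p

sum-map-0 : ∀ (xs : List A) → sum (map (λ _ → 0) xs) ≡ 0
sum-map-0 []       = refl
sum-map-0 (_ ∷ xs) = sum-map-0 xs

length≡sum-map-1 : ∀ (xs : List A) → length xs ≡ sum (map (λ _ → 1) xs)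
length≡sum-map-1 []       = refl
length≡sum-map-1 (_ ∷ xs) = cong suc (length≡sum-map-1 xs)

sum-map-+ : ∀ (f g : A → ℕ) xs → sum (map (λ x → f x + g x) xs) ≡ sum (map f xs) + sum (map g xs)
sum-map-+ f g []       = refl
sum-map-+ f g (x ∷ xs) = begin
  f x + g x + sum (map (λ x → f x + g x) xs)        ≡⟨ cong (f x + g x +_) (sum-map-+ f g xs) ⟩
  f x + g x + (sum (map f xs) + sum (map g xs))    ≡⟨ interchange (f x) (g x) _ _ ⟩
  f x + sum (map f xs) + (g x + sum (map g xs))    ∎

sum-map-comm : ∀ (g : A → B → ℕ) xs (ys : List B) →
               sum (map (λ x → sum (map (g x) ys)) xs) ≡ sum (map (λ y → sum (map (λ x → g x y) xs)) ys)
sum-map-comm g []       ys = sym (sum-map-0 ys)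
sum-map-comm g (x ∷ xs) ys = begin
  sum (map (g x) ys) + sum (map (λ x → sum (map (g x) ys)) xs)
    ≡⟨ cong (sum (map (g x) ys) +_) (sum-map-comm g xs ys) ⟩
  sum (map (g x) ys) + sum (map (λ y → sum (map (λ x → g x y) xs)) ys)
    ≡⟨ sum-map-+ (g x) (λ y → sum (map (λ x → g x y) xs)) ys ⟨
  sum (map (λ y → g x y + sum (map (λ x → g x y) xs)) ys) ∎

module _ {P : Pred A p} (P? : Decidable P) where

  length-filter≡sum-indicator : ∀ xs → length (filter P? xs) ≡ sum (map (indicator ∘ P?) xs)
  length-filter≡sum-indicator []       = refl
  length-filter≡sum-indicator (x ∷ xs) with P? x
  ... | yes _ = cong suc (length-filter≡sum-indicator xs)
  ... | no _  = length-filter≡sum-indicator xs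

length-partition : ∀ {P : Pred A p} {Q : I → Pred A p}
  (P? : Decidable P) (Q? : ∀ i → Decidable (Q i)) (is : List I) xs →
  (∀ {x} → x ∈ₗ xs → indicator (P? x) + sum (map (λ i → indicator (Q? i x)) is) ≡ 1) →
  length xs ≡ length (filter P? xs) + sum (map (λ i → length (filter (Q? i) xs)) is)
length-partition P? Q? is xs exactly-one = begin
  length xs
    ≡⟨ length≡sum-map-1 xs ⟩
  sum (map (λ _ → 1) xs)
    ≡⟨ cong sum (map-cong-local (All.tabulate exactly-one)) ⟨
  sum (map (λ x → indicator (P? x) + sum (map (λ i → indicator (Q? i x)) is)) xs)
    ≡⟨ sum-map-+ (indicator ∘ P?) (λ x → sum (map (λ i → indicator (Q? i x)) is)) xs ⟩
  sum (map (indicator ∘ P?) xs) + sum (map (λ x → sum (map (λ i → indicator (Q? i x)) is)) xs)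
    ≡⟨ cong₂ _+_ (sym (length-filter≡sum-indicator P? xs)) (sum-map-comm (λ x i → indicator (Q? i x)) xs is) ⟩
  length (filter P? xs) + sum (map (λ i → sum (map (indicator ∘ Q? i) xs)) is)
    ≡⟨ cong (λ s → length (filter P? xs) + sum s) (map-cong (λ i → length-filter≡sum-indicator (Q? i) xs) is) ⟨
  length (filter P? xs) + sum (map (λ i → length (filter (Q? i) xs)) is) ∎

sum-map-allFin-suc : ∀ m (h : Fin (suc m) → ℕ) →
  sum (map h (allFin (suc m))) ≡ h fzero + sum (map (h ∘ fsuc) (allFin m))
sum-map-allFin-suc m h = cong (λ hs → h fzero + sum hs)
  (trans (map-tabulate fsuc h) (sym (map-tabulate (λ i → i) (h ∘ fsuc))))

sum-telescope : ∀ m (f : Fin (suc m) → ℕ) → (∀ i → f (fsuc i) ℕ.≤ f (inject₁ i)) →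
  sum (map (λ i → f (inject₁ i) ∸ f (fsuc i)) (allFin m)) + f (fromℕ m) ≡ f fzero
sum-telescope zero    f f-antitone = refl
sum-telescope (suc m) f f-antitone = begin
  sum (map drop (allFin (suc m))) + f (fromℕ (suc m))
    ≡⟨ cong (_+ f (fromℕ (suc m))) (sum-map-allFin-suc m drop) ⟩
  drop fzero + sum (map (drop ∘ fsuc) (allFin m)) + f (fromℕ (suc m))
    ≡⟨ ℕₚ.+-assoc (drop fzero) _ _ ⟩
  drop fzero + (sum (map (drop ∘ fsuc) (allFin m)) + f (fsuc (fromℕ m)))
    ≡⟨ cong (drop fzero +_) (sum-telescope m (f ∘ fsuc) (f-antitone ∘ fsuc)) ⟩
  (f fzero ∸ f (fsuc fzero)) + f (fsuc fzero)
    ≡⟨ ℕₚ.m∸n+n≡m (f-antitone fzero) ⟩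
  f fzero ∎
  where
  drop : Fin (suc m) → ℕ
  drop i = f (inject₁ i) ∸ f (fsuc i)

module _ (_≟_ : DecidableEquality A) where

  deduplicate-id : ∀ {xs} → Unique xs → deduplicate _≟_ xs ≡ xs
  deduplicate-id {[]}     []            = refl
  deduplicate-id {x ∷ xs} (x∉xs ∷ uniq) =
    cong (x ∷_) (trans (cong (filter (¬? ∘ (x ≟_))) (deduplicate-id uniq)) (filter-all (¬? ∘ (x ≟_)) x∉xs))

  length-filter-≟-Unique : ∀ {y xs} → Unique xs → y ∈ₗ xs → length (filter (_≟ y) xs) ≡ 1
  length-filter-≟-Unique {y} {y ∷ xs} (y∉xs ∷ _) (here refl) =
    cong length (trans (filter-accept (_≟ y) refl)
                       (cong (y ∷_) (filter-none (_≟ y) (All.map (λ y≢x x≡y → y≢x (sym x≡y)) y∉xs))))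
  length-filter-≟-Unique {y} {x ∷ xs} (x∉xs ∷ uniq) (there y∈xs) =
    trans (cong length (filter-reject (_≟ y) (All.lookup x∉xs y∈xs)))
          (length-filter-≟-Unique uniq y∈xs)

Unique-map⁺ : ∀ {f : A → B} {P : Pred A p} → (∀ {x y} → P x → P y → f x ≡ f y → x ≡ y) →
              ∀ {xs} → All P xs → Unique xs → Unique (map f xs)
Unique-map⁺ f-inj []         []            = []
Unique-map⁺ f-inj (px ∷ pxs) (x∉xs ∷ uniq) =
  All-map⁺ (All.zipWith (λ (py , x≢y) fx≡fy → x≢y (f-inj px py fx≡fy)) (pxs , x∉xs))
  ∷ Unique-map⁺ f-inj pxs uniq

x∈p─q⇒x∉q : ∀ {n} (p q : Subset n) {x} → x ∈ p ─ q → x ∉ q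
x∈p─q⇒x∉q (_ ∷ p) (outside ∷ q) Vec.here       ()
x∈p─q⇒x∉q (_ ∷ p) (_ ∷ q)       (Vec.there x∈) (Vec.there x∈q) = x∈p─q⇒x∉q p q x∈ x∈q

module _ {n : ℕ} where

  ∪-lub : ∀ {p q r : Subset n} → p ⊆ r → q ⊆ r → p ∪ q ⊆ r
  ∪-lub {p} {q} p⊆r q⊆r x∈ = [ p⊆r , q⊆r ] (x∈p∪q⁻ p q x∈)

  ─-cancelʳ : ∀ {p q r : Subset n} → r ⊆ p → r ⊆ q → p ─ r ≡ q ─ r → p ≡ q
  ─-cancelʳ r⊆p r⊆q eq = ⊆-antisym (─≡⇒⊆ r⊆q eq) (─≡⇒⊆ r⊆p (sym eq))
    where
    ─≡⇒⊆ : ∀ {p q r : Subset n} → r ⊆ q → p ─ r ≡ q ─ r → p ⊆ q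
    ─≡⇒⊆ {p} {q} {r} r⊆q eq {x} x∈p with x ∈? r
    ... | yes x∈r = r⊆q x∈r
    ... | no  x∉r = p─q⊆p q r (subst (x ∈_) eq (x∈p∧x∉q⇒x∈p─q x∈p x∉r))

  ⊈⇒Nonempty─ : ∀ {p q : Subset n} → ¬ p ⊆ q → Nonempty (p ─ q)
  ⊈⇒Nonempty─ {p} {q} p⊈q with any? (_∈? p ─ q)
  ... | yes nonempty = nonempty
  ... | no  empty    = ⊥-elim (p⊈q p⊆q)
    where
    p⊆q : p ⊆ q
    p⊆q {x} x∈p with x ∈? q
    ... | yes x∈q = x∈q
    ... | no  x∉q = contradiction (x , x∈p∧x∉q⇒x∈p─q x∈p x∉q) empty

  ∩≡⊥⇒∉ : ∀ {p q : Subset n} {x} → p ∩ q ≡ ⊥ → x ∈ p → x ∉ q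
  ∩≡⊥⇒∉ p∩q≡⊥ x∈p x∈q = ∉⊥ (subst (_ ∈_) p∩q≡⊥ (x∈p∩q⁺ (x∈p , x∈q)))

  ∉⇒∩≡⊥ : ∀ {p q : Subset n} → (∀ {x} → x ∈ p → x ∉ q) → p ∩ q ≡ ⊥
  ∉⇒∩≡⊥ {p} {q} disjoint = Empty-unique λ (x , x∈p∩q) →
    let x∈p , x∈q = x∈p∩q⁻ p q x∈p∩q in disjoint x∈p x∈q

  ∈-⋃⁺ : ∀ {ps : List (Subset n)} {p x} → p ∈ₗ ps → x ∈ p → x ∈ ⋃ ps
  ∈-⋃⁺ (here refl)  x∈p = x∈p∪q⁺ (inj₁ x∈p)
  ∈-⋃⁺ (there p∈ps) x∈p = x∈p∪q⁺ (inj₂ (∈-⋃⁺ p∈ps x∈p))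

  ∈-⋃⁻ : ∀ (ps : List (Subset n)) {x} → x ∈ ⋃ ps → ∃ λ p → p ∈ₗ ps × x ∈ p
  ∈-⋃⁻ []       x∈⊥ = contradiction x∈⊥ ∉⊥
  ∈-⋃⁻ (p ∷ ps) x∈  with x∈p∪q⁻ p (⋃ ps) x∈
  ... | inj₁ x∈p = p , here refl , x∈p
  ... | inj₂ x∈⋃ with ∈-⋃⁻ ps x∈⋃
  ...   | q , q∈ps , x∈q = q , there q∈ps , x∈q

module _ {r} {_∼_ : A → A → Set r} (∼-refl : Reflexive _∼_) (∼-trans : Transitive _∼_) where

  antitone-by-steps : ∀ {m} (f : Fin (suc m) → A) → (∀ i → f (fsuc i) ∼ f (inject₁ i)) →
                      ∀ {i j} → i ≤ j → f j ∼ f i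
  antitone-by-steps f step {fzero}  {fzero}  _ = ∼-refl
  antitone-by-steps {m = suc m} f step {fzero} {fsuc j} _ =
    ∼-trans (antitone-by-steps (f ∘ fsuc) (step ∘ fsuc) {fzero} {j} z≤n) (step fzero)
  antitone-by-steps {m = suc m} f step {fsuc i} {fsuc j} i≤j =
    antitone-by-steps (f ∘ fsuc) (step ∘ fsuc) (s≤s⁻¹ i≤j)

≰-inject₁⇒suc≤ : ∀ {m} {i : Fin m} {j : Fin (suc m)} → ¬ j ≤ inject₁ i → fsuc i ≤ j
≰-inject₁⇒suc≤ {i = i} j≰i = subst (ℕ._< _) (toℕ-inject₁ i) (ℕₚ.≰⇒> j≰i)

∃-drop-before : ∀ {m} {P : Pred (Fin (suc m)) p} → Decidable P → P fzero →
                ∀ k → ¬ P k → ∃ λ j → fsuc j ≤ k × P (inject₁ j) × ¬ P (fsuc j)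
∃-drop-before P? P₀ fzero ¬P₀ = contradiction P₀ ¬P₀
∃-drop-before {m = suc m} P? P₀ (fsuc k) ¬Pk with P? (fsuc fzero)
... | no ¬P₁ = fzero , s≤s z≤n , P₀ , ¬P₁
... | yes P₁ with ∃-drop-before (P? ∘ fsuc) P₁ k ¬Pk
...   | j , j<k , Pj , ¬Pj+1 = fsuc j , s≤s j<k , Pj , ¬Pj+1

module _ {n ℓ} (A : Family n) (C : Fin (suc ℓ) → Subset n) where

  length-𝒟≡length-𝒞 : Unique A → ∀ i → length (𝒟 A C i) ≡ length (𝒞 A C i)
  length-𝒟≡length-𝒞 unique i = begin
    length (deduplicate _≟ˢ_ (map (_─ Δ A C i) (𝒞 A C i)))  ≡⟨ cong length (deduplicate-id _≟ˢ_ unique-image) ⟩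
    length (map (_─ Δ A C i) (𝒞 A C i))                      ≡⟨ length-map (_─ Δ A C i) (𝒞 A C i) ⟩
    length (𝒞 A C i)                                        ∎
    where
    unique-image : Unique (map (_─ Δ A C i) (𝒞 A C i))
    unique-image = Unique-map⁺ ─-cancelʳ (All.map proj₁ (all-filter (inC? A C i) A))
                               (Unique.filter⁺ (inC? A C i) unique)

  ∈-before⁻ : ∀ {i x} → x ∈ before A C i → ∃ λ j → j < i × x ∈ Δ A C j
  ∈-before⁻ {i} x∈ with ∈-⋃⁻ (map (Δ A C) (filter (λ j → toℕ j ℕ.<? toℕ i) (allFin ℓ))) x∈
  ... | _ , Δj∈ , x∈Δj with ∈-map⁻ (Δ A C) Δj∈
  ...   | j , j∈ , refl = j , proj₂ (∈-filter⁻ (λ j → toℕ j ℕ.<? toℕ i) {xs = allFin ℓ} j∈) , x∈Δj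

  ∈-before⁺ : ∀ {i j x} → j < i → x ∈ Δ A C j → x ∈ before A C i
  ∈-before⁺ {i} {j} j<i = ∈-⋃⁺ (∈-map⁺ (Δ A C) (∈-filter⁺ (λ j → toℕ j ℕ.<? toℕ i) (∈-allFin j) j<i))

module MaximalChain {n ℓ} {A : Family n} {C : Fin (suc ℓ) → Subset n} (maxChain : IsMaxChain ℓ A C) where

  C∈A : ∀ i → C i ∈ₗ A
  C∈A = proj₁ maxChain

  C-step : ∀ i → C (fsuc i) ⊆ C (inject₁ i)
  C-step i = proj₁ (proj₁ (proj₂ maxChain) i)

  C-step-⊉ : ∀ i → ¬ C (inject₁ i) ⊆ C (fsuc i)
  C-step-⊉ i ⊇ = proj₂ (proj₁ (proj₂ maxChain) i) (⊆-antisym (C-step i) ⊇)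

  DropsAt : Subset n → Fin ℓ → Set
  DropsAt X i = X ⊆ C (inject₁ i) × ¬ X ⊆ C (fsuc i)

  ⊆-next⇒⊆ : ∀ {X} i → X ⊆ C (fsuc i) → X ⊆ C (inject₁ i)
  ⊆-next⇒⊆ i X⊆C = ⊆-trans X⊆C (C-step i)

  C-antitone : ∀ {i j} → i ≤ j → C j ⊆ C i
  C-antitone = antitone-by-steps {_∼_ = _⊆_} ⊆-refl ⊆-trans C C-step

  ⊆⇒≤ : ∀ {i j} → C j ⊆ C i → i ≤ j
  ⊆⇒≤ {fzero}  _     = z≤n
  ⊆⇒≤ {fsuc k} {j} Cj⊆Ci with j ≤? inject₁ k
  ... | yes j≤k = ⊥-elim (C-step-⊉ k (⊆-trans (C-antitone j≤k) Cj⊆Ci))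
  ... | no  j≰k = ≰-inject₁⇒suc≤ j≰k

  C-injective : ∀ {i j} → C i ≡ C j → i ≡ j
  C-injective Ci≡Cj = ≤-antisym (⊆⇒≤ (⊆-reflexive (sym Ci≡Cj))) (⊆⇒≤ (⊆-reflexive Ci≡Cj))

  C-isChain : IsChainIn A (tabulate C)
  C-isChain =
    All-tabulate⁺ C∈A ,
    tabulate⁺-< (λ i<j → <⇒≢ i<j ∘ C-injective) ,
    tabulate⁺-< (λ i<j → inj₂ (C-antitone (ℕₚ.<⇒≤ i<j)))

  comparable⇒≡C : ∀ {Y} → Y ∈ₗ A → (∀ j → Comparable Y (C j)) → ∃ λ j → Y ≡ C j
  comparable⇒≡C {Y} Y∈A comparable with any? (λ j → Y ≟ˢ C j)
  ... | yes Y∈C = Y∈C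
  ... | no  Y∉C = contradiction (proj₂ (proj₂ maxChain) (Y ∷ tabulate C) extended-chain) too-long
    where
    extended-chain : IsChainIn A (Y ∷ tabulate C)
    extended-chain = Y∈A ∷ proj₁ C-isChain ,
                     All-tabulate⁺ (λ j Y≡Cj → Y∉C (j , Y≡Cj)) ∷ proj₁ (proj₂ C-isChain) ,
                     All-tabulate⁺ comparable ∷ proj₂ (proj₂ C-isChain)
    too-long : ¬ length (Y ∷ tabulate C) ℕ.≤ suc ℓ
    too-long = ℕₚ.1+n≰n ∘ subst (λ k → suc k ℕ.≤ suc ℓ) (length-tabulate C)

  ⊆-bottom⇒≡ : ∀ {Y} → Y ∈ₗ A → Y ⊆ C (fromℕ ℓ) → Y ≡ C (fromℕ ℓ)
  ⊆-bottom⇒≡ Y∈A Y⊆ with comparable⇒≡C Y∈A (λ j → inj₁ (⊆-trans Y⊆ (C-antitone (≤fromℕ j))))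
  ... | j , refl = cong C (≤-antisym (≤fromℕ j) (⊆⇒≤ Y⊆))

  between-step⇒comparable : ∀ {Y i} → C (fsuc i) ⊆ Y → Y ⊆ C (inject₁ i) → ∀ j → Comparable Y (C j)
  between-step⇒comparable {i = i} C⊆Y Y⊆C j with j ≤? inject₁ i
  ... | yes j≤i = inj₁ (⊆-trans Y⊆C (C-antitone j≤i))
  ... | no  j≰i = inj₂ (⊆-trans (C-antitone (≰-inject₁⇒suc≤ j≰i)) C⊆Y)

  between-step⇒≡ : ∀ {Y i} → Y ∈ₗ A → C (fsuc i) ⊆ Y → DropsAt Y i → Y ≡ C (inject₁ i)
  between-step⇒≡ {i = i} Y∈A C⊆Y (Y⊆C , Y⊈C)
    with comparable⇒≡C Y∈A (between-step⇒comparable C⊆Y Y⊆C)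
  ... | j , refl with j ≤? inject₁ i
  ...   | yes j≤i = cong C (≤-antisym j≤i (⊆⇒≤ Y⊆C))
  ...   | no  j≰i = ⊥-elim (Y⊈C (C-antitone (≰-inject₁⇒suc≤ j≰i)))

  Δ-nonempty : ∀ i → Nonempty (Δ A C i)
  Δ-nonempty i = ⊈⇒Nonempty─ (C-step-⊉ i)

  ∈-before⇒∉ : ∀ {i x} → x ∈ before A C i → x ∉ C (inject₁ i)
  ∈-before⇒∉ {i} x∈ with ∈-before⁻ A C x∈
  ... | j , j<i , x∈Δj = x∈p─q⇒x∉q (C (inject₁ j)) (C (fsuc j)) x∈Δj ∘ C-antitone j+1≤i
    where
    j+1≤i : fsuc j ≤ inject₁ i
    j+1≤i = subst (suc (toℕ j) ℕ.≤_) (sym (toℕ-inject₁ i)) j<i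

  Δ⊆⇒⊈-next : ∀ {X i} → Δ A C i ⊆ X → ¬ X ⊆ C (fsuc i)
  Δ⊆⇒⊈-next {i = i} Δ⊆X X⊆C with Δ-nonempty i
  ... | _ , x∈Δ = x∈p─q⇒x∉q (C (inject₁ i)) (C (fsuc i)) x∈Δ (X⊆C (Δ⊆X x∈Δ))

  module _ (union-closed : UnionClosed A) where

    ∪-next≡C : ∀ {X i} → X ∈ₗ A → DropsAt X i → X ∪ C (fsuc i) ≡ C (inject₁ i)
    ∪-next≡C {X} {i} X∈A (X⊆C , X⊈C) =
      between-step⇒≡ (union-closed X (C (fsuc i)) X∈A (C∈A (fsuc i))) (q⊆p∪q X (C (fsuc i)))
        (∪-lub X⊆C (C-step i) , λ X∪C⊆C → X⊈C (⊆-trans (p⊆p∪q (C (fsuc i))) X∪C⊆C))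

    DropsAt⇒Δ⊆ : ∀ {X i} → X ∈ₗ A → DropsAt X i → Δ A C i ⊆ X
    DropsAt⇒Δ⊆ {X} {i} X∈A drops {x} x∈Δ
      with x∈p∪q⁻ X (C (fsuc i)) (subst (x ∈_) (sym (∪-next≡C X∈A drops)) (p─q⊆p _ _ x∈Δ))
    ... | inj₁ x∈X = x∈X
    ... | inj₂ x∈C = contradiction x∈C (x∈p─q⇒x∉q (C (inject₁ i)) (C (fsuc i)) x∈Δ)

  module _ (C₀≡⊤ : C fzero ≡ ⊤) where

    ∈C₀ : ∀ {x} → x ∈ C fzero
    ∈C₀ = subst (_ ∈_) (sym C₀≡⊤) ∈⊤

    ∉⇒∈-before : ∀ {i x} → x ∉ C (inject₁ i) → x ∈ before A C i
    ∉⇒∈-before {i} {x} x∉C with ∃-drop-before (λ k → x ∈? C k) ∈C₀ (inject₁ i) x∉C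
    ... | j , j+1≤i , x∈Cj , x∉Cj+1 =
      ∈-before⁺ A C (subst (suc (toℕ j) ℕ.≤_) (toℕ-inject₁ i) j+1≤i) (x∈p∧x∉q⇒x∈p─q x∈Cj x∉Cj+1)

    ∩-before≡⊥⇔⊆ : ∀ {X i} → (X ∩ before A C i ≡ ⊥) ⇔ X ⊆ C (inject₁ i)
    ∩-before≡⊥⇔⊆ {X} {i} = mk⇔ to (λ X⊆C → ∉⇒∩≡⊥ (λ x∈X x∈B → ∈-before⇒∉ x∈B (X⊆C x∈X)))
      where
      to : X ∩ before A C i ≡ ⊥ → X ⊆ C (inject₁ i)
      to X∩B≡⊥ {x} x∈X with x ∈? C (inject₁ i)
      ... | yes x∈C = x∈C
      ... | no  x∉C = contradiction (∉⇒∈-before x∉C) (∩≡⊥⇒∉ X∩B≡⊥ x∈X)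

    module _ (union-closed : UnionClosed A) where

      ∈𝒞⇔DropsAt : ∀ {X i} → X ∈ₗ A → (Δ A C i ⊆ X × X ∩ before A C i ≡ ⊥) ⇔ DropsAt X i
      ∈𝒞⇔DropsAt {X} {i} X∈A = mk⇔ to from
        where
        to : Δ A C i ⊆ X × X ∩ before A C i ≡ ⊥ → DropsAt X i
        to (Δ⊆X , X∩B≡⊥) = Equivalence.to ∩-before≡⊥⇔⊆ X∩B≡⊥ , Δ⊆⇒⊈-next Δ⊆X
        from : DropsAt X i → Δ A C i ⊆ X × X ∩ before A C i ≡ ⊥
        from drops = DropsAt⇒Δ⊆ union-closed X∈A drops , Equivalence.from ∩-before≡⊥⇔⊆ (proj₁ drops)

      indicator-∈𝒞 : ∀ {X i} → X ∈ₗ A →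
        indicator (inC? A C i X) ≡ indicator (X ⊆? C (inject₁ i)) ∸ indicator (X ⊆? C (fsuc i))
      indicator-∈𝒞 {X} {i} X∈A = begin
        indicator (inC? A C i X)
          ≡⟨ indicator-cong (inC? A C i X) ((X ⊆? C (inject₁ i)) ×-dec ¬? (X ⊆? C (fsuc i))) (∈𝒞⇔DropsAt X∈A) ⟩
        indicator ((X ⊆? C (inject₁ i)) ×-dec ¬? (X ⊆? C (fsuc i)))
          ≡⟨ indicator-×-¬ (X ⊆? C (inject₁ i)) (X ⊆? C (fsuc i)) (⊆-next⇒⊆ i) ⟩
        indicator (X ⊆? C (inject₁ i)) ∸ indicator (X ⊆? C (fsuc i)) ∎

      indicator-bottom+sum-𝒞≡1 : ∀ {X} → X ∈ₗ A →
        indicator (X ≟ˢ C (fromℕ ℓ)) + sum (map (λ i → indicator (inC? A C i X)) (allFin ℓ)) ≡ 1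
      indicator-bottom+sum-𝒞≡1 {X} X∈A = begin
        indicator (X ≟ˢ C (fromℕ ℓ)) + sum (map (λ i → indicator (inC? A C i X)) (allFin ℓ))
          ≡⟨ cong₂ _+_ (indicator-cong (X ≟ˢ C (fromℕ ℓ)) (X ⊆? C (fromℕ ℓ)) bottom⇔)
                       (cong sum (map-cong (λ _ → indicator-∈𝒞 X∈A) (allFin ℓ))) ⟩
        inside (fromℕ ℓ) + sum (map (λ i → inside (inject₁ i) ∸ inside (fsuc i)) (allFin ℓ))
          ≡⟨ ℕₚ.+-comm (inside (fromℕ ℓ)) _ ⟩
        sum (map (λ i → inside (inject₁ i) ∸ inside (fsuc i)) (allFin ℓ)) + inside (fromℕ ℓ)
          ≡⟨ sum-telescope ℓ inside inside-antitone ⟩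
        inside fzero
          ≡⟨ indicator-yes (X ⊆? C fzero) (λ _ → ∈C₀) ⟩
        1 ∎
        where
        inside : Fin (suc ℓ) → ℕ
        inside k = indicator (X ⊆? C k)
        inside-antitone : ∀ i → inside (fsuc i) ℕ.≤ inside (inject₁ i)
        inside-antitone i = indicator-mono (X ⊆? C (inject₁ i)) (X ⊆? C (fsuc i)) (⊆-next⇒⊆ i)
        bottom⇔ : (X ≡ C (fromℕ ℓ)) ⇔ X ⊆ C (fromℕ ℓ)
        bottom⇔ = mk⇔ ⊆-reflexive (⊆-bottom⇒≡ X∈A)

theorem3p2 : ∀ {n ℓ : ℕ} (A : Family n) (C : Fin (suc ℓ) → Subset n) →
    IsFamily A → UnionClosed A → HasUniverse A →
    IsMaxChain ℓ A C → C fzero ≡ ⊤ →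
    length A ≡ 1 + sumD A C
theorem3p2 {ℓ = ℓ} A C (unique , _) union-closed _ maxChain C₀≡⊤ = begin
  length A
    ≡⟨ length-partition (_≟ˢ C (fromℕ ℓ)) (inC? A C) (allFin ℓ) A
         (indicator-bottom+sum-𝒞≡1 C₀≡⊤ union-closed) ⟩
  length (filter (_≟ˢ C (fromℕ ℓ)) A) + sum (map (λ i → length (𝒞 A C i)) (allFin ℓ))
    ≡⟨ cong₂ _+_ (length-filter-≟-Unique _≟ˢ_ unique (C∈A (fromℕ ℓ)))
                 (cong sum (map-cong (sym ∘ length-𝒟≡length-𝒞 A C unique) (allFin ℓ))) ⟩
  1 + sumD A C ∎
  where open MaximalChain maxChain
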